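{- Let $r\ge 2$, let $Q_1,\dots,Q_{2^{r-1}}$ be all the $r$-partite $r$-patterns, and let $a_1,\dots,a_{2^{r-1}}$ be positive integers. If $n\ge\prod_{i=1}^{2^{r-1}}a_i+1$, then every $r$-partite ordered $r$-matching of size $n$ contains a $Q_i$-clique of size at least $a_i+1$, for some $i\in[2^{r-1}]$. Moreover, this is not true for $n=\prod_{i=1}^{2^{r-1}}a_i$: there is an $r$-partite ordered $r$-matching of that size containing no $Q_i$-clique of size $a_i+1$ for any $i$.
   Context: An ordered $r$-matching of size $k$ is a set of $k$ pairwise disjoint $r$-element subsets (edges) of $[rk]$ covering $[rk]$, considered up to order-isomorphism. It is $r$-partite if, after splitting $[rk]$ into $r$ consecutive intervals of size $k$, every edge contains exactly one vertex from each interval. An $r$-pattern is an ordered $r$-matching of size two (written as a word in letters $A,B$, each occurring $r$ times); the $r$-partite $r$-patterns are those that are $r$-partite in this sense (there are $2^{r-1}$ of them). Two edges $e,f$ of a matching form pattern $P$ if the sub-matching $\{e,f\}$ with the induced order is order-isomorphic to $P$. A $P$-clique is a matching in which every pair of edges forms $P$ (a single edge counts as a $P$-clique). -}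

module Defs where

open import Data.Nat using (ℕ; zero; suc; _+_; _*_; _∸_; _≤_; _<_; _≤ᵇ_; _<ᵇ_)
open import Data.Bool using (Bool; true; false; if_then_else_; _∧_; _∨_)
open import Data.Fin using (Fin; toℕ)
open import Data.Fin.Properties using () renaming (_≟_ to _≟F_)
open import Data.Fin.Subset using (Subset; _∈_; ∣_∣)
open import Data.List using (List; []; _∷_; length; filterᵇ; map; concat)
open import Data.List.Base using (allFin)
open import Data.Vec using (Vec; []; _∷_; toList)
open import Data.Product using (Σ; _×_)
open import Data.Sum using (_⊎_)
open import Relation.Nullary using (¬_)
open import Relation.Nullary.Decidable using (⌊_⌋)
open import Relation.Binary.PropositionalEquality using (_≡_; _≢_)

countᵇ : {m : ℕ} → (Fin m → Bool) → ℕ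
countᵇ {m} p = length (filterᵇ p (allFin m))

-- An ordered r-matching of size n on the ordered vertex set [r n] = Fin (r * n)
-- (natural order of Fin).  The edges are labelled by Fin n:  edgeOf v  is the
-- edge containing vertex v, and every edge has exactly r vertices.
-- (Labelling edges is harmless: all statements below are invariant under relabelling.)
record OrderedMatching (r n : ℕ) : Set where
  field
    edgeOf   : Fin (r * n) → Fin n
    edgeSize : (e : Fin n) → countᵇ (λ v → ⌊ edgeOf v ≟F e ⌋) ≡ r
open OrderedMatching public

inInterval : {r n : ℕ} → Fin r → Fin (r * n) → Bool
inInterval {r} {n} j v = ((toℕ j * n) ≤ᵇ toℕ v) ∧ (toℕ v <ᵇ (suc (toℕ j) * n))

IsPartite : {r n : ℕ} → OrderedMatching r n → Set
IsPartite {r} {n} M =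
  (e : Fin n) (j : Fin r) →
    countᵇ (λ v → ⌊ edgeOf M v ≟F e ⌋ ∧ inInterval j v) ≡ 1

PartiteMatching : ℕ → ℕ → Set
PartiteMatching r n = Σ (OrderedMatching r n) IsPartite

-- An r-pattern is written as a word in letters A, B; we encode A = true, B = false.
-- word M e f : the induced order of the sub-matching {e , f}, read left to right,
-- with letter A for vertices of e and B for vertices of f.
word : {r n : ℕ} → OrderedMatching r n → Fin n → Fin n → List Bool
word {r} {n} M e f =
  map (λ v → ⌊ edgeOf M v ≟F e ⌋)
      (filterᵇ (λ v → ⌊ edgeOf M v ≟F e ⌋ ∨ ⌊ edgeOf M v ≟F f ⌋) (allFin (r * n)))

-- edges e, f form pattern P (P written as a word beginning with A):
-- {e , f} is order-isomorphic to P, with either edge playing the role of A.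
Forms : {r n : ℕ} → OrderedMatching r n → Fin n → Fin n → List Bool → Set
Forms M e f P = (word M e f ≡ P) ⊎ (word M f e ≡ P)

IsClique : {r n : ℕ} → OrderedMatching r n → List Bool → Subset n → Set
IsClique {r} {n} M P S =
  (e f : Fin n) → e ∈ S → f ∈ S → e ≢ f → Forms M e f P

-- This enumerates all 2^(r-1) r-partite r-patterns (written starting with A).
partitePattern : {k : ℕ} → Vec Bool k → List Bool
partitePattern b =
  true ∷ false ∷ concat (map (λ x → if x then true ∷ false ∷ [] else false ∷ true ∷ [])
                             (toList b))

prodAll : (k : ℕ) → (Vec Bool k → ℕ) → ℕ
prodAll zero    a = a []
prodAll (suc k) a = prodAll k (λ b → a (true ∷ b)) * prodAll k (λ b → a (false ∷ b))

-- In an r-partite matching every edge meets each interval once, so the matching is given by r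
-- linear orders of its edges (their offsets within the intervals).  Two edges form the pattern
-- indexed by b exactly when, calling A the edge that comes first in interval 0, their order in
-- interval j + 1 is AB or BA as b_j says.  For fixed b this "precedes" relation is a strict
-- partial order, any two distinct edges are related for some b, and a chain is a clique.
-- Upper bound: label each edge by its vector of chain heights, the height for b capped at a_b;
-- with more than ∏ a_b edges two labels coincide, and the pattern relating those two edges
-- has a chain longer than a_b.  Lower bound: order ∏ a_b = N_true * N_false lexicographically,
-- combining constructions for the two halves of the patterns, with intervals 0 and 1 ordering
-- the second factor oppositely; then the letter of block 1 tells whether two edges differ in
-- the first factor, and colouring by the corresponding factor gives the a_b colours that every
-- Q_b-clique must use distinctly.

module Submission where

open import Defs
open import Data.Bool using (Bool; true; false; T; T?; if_then_else_; _∧_; _∨_)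
import Data.Bool.Properties as Boolₚ
open import Data.Bool.Properties using (∧-zeroʳ; ∧-identityʳ)
open import Data.Empty using (⊥-elim)
open import Data.Fin using (Fin; zero; suc; toℕ; combine; remQuot; opposite; fromℕ<; _↑ˡ_; _↑ʳ_)
open import Data.Fin.Permutation using (Permutation′; _⟨$⟩ʳ_; _⟨$⟩ˡ_; _∘ₚ_; inverseˡ; inverseʳ; reverse)
  renaming (id to idₚ)
import Data.Fin.Properties as Finₚ
open import Data.Fin.Properties using (toℕ-combine; toℕ<n; toℕ-injective; suc-injective; 0≢1+n; *↔×)
  renaming (_≟_ to _≟F_)
open import Data.Fin.Subset using (Subset; ⁅_⁆; ⋃; ∣_∣; _-_; inside; outside)
  renaming (⊤ to full; _∈_ to _∈ₛ_)
open import Data.Fin.Subset.Properties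
  using (x∈⁅x⁆; x∈⁅y⁆⇒x≡y; x∈p∪q⁺; x∈p∪q⁻; q⊆p∪q; p⊂q⇒∣p∣<∣q∣; ∉⊥; x∈p∧x≢y⇒x∈p-y;
         x∈p⇒∣p-x∣<∣p∣; ∣⊤∣≡n; ∈⊤)
open import Data.List using (List; []; _∷_; length; filterᵇ; map; concat; _++_; tabulate; allFin; filter)
open import Data.List.Properties
  using (length-map; length-++; length-tabulate; tabulate-cong; map-tabulate; ++-identityʳ; ∷-injective; map-∘; concat-map;
         map-cong-local; filter-++; filter-none; filter-≐)
open import Data.List.Extrema.Nat using (max; xs≤max; argmax-sel)
open import Data.List.Membership.Propositional using () renaming (_∈_ to _∈ₗ_)
open import Data.List.Membership.Propositional.Properties using (∈-filter⁺; ∈-filter⁻; ∈-allFin; ∈-map⁺; ∈-map⁻)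
open import Data.List.Relation.Unary.Any using (here; there)
open import Data.List.Relation.Unary.All as All using ([]; _∷_) renaming (lookup to All-lookup; map to All-map)
open import Data.List.Relation.Unary.AllPairs as AllPairs using (AllPairs; []; _∷_)
open import Data.List.Relation.Unary.Unique.Propositional using (Unique)
open import Data.Nat using (ℕ; zero; suc; _+_; _*_; _∸_; _≤_; _<_; _<ᵇ_; _≤ᵇ_; z≤n; s≤s; _⊓_)
open import Data.Nat.Properties as ℕₚ using (≤-refl; ≤-trans; ≤-reflexive; <-≤-trans; <-irrefl)
open import Data.Product using (Σ; _×_; _,_; proj₁; proj₂)
open import Data.Product.Function.NonDependent.Propositional using (_×-↔_)
open import Data.Sum using (_⊎_; inj₁; inj₂)
open import Data.Vec using (Vec; []; _∷_; lookup; toList) renaming (here to hereₛ; there to thereₛ)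
import Data.Vec as Vec
open import Data.Vec.Properties using (lookup∘tabulate)
open import Function.Bundles using (_⇔_; mk⇔; Equivalence; Injection)
open import Function.Properties.Inverse using (↔-trans; ↔-sym; ↔⇒↣)
open import Relation.Binary.Definitions using (tri<; tri≈; tri>)
open import Relation.Binary.PropositionalEquality
open import Relation.Nullary using (yes; no; Dec)
open import Relation.Nullary.Decidable using (⌊_⌋)

<⇒<ᵇ≡true : {m n : ℕ} → m < n → (m <ᵇ n) ≡ true
<⇒<ᵇ≡true {zero}  (s≤s _)   = refl
<⇒<ᵇ≡true {suc m} (s≤s m<n) = <⇒<ᵇ≡true m<n

≤⇒<ᵇ≡false : {m n : ℕ} → n ≤ m → (m <ᵇ n) ≡ false
≤⇒<ᵇ≡false z≤n       = refl
≤⇒<ᵇ≡false (s≤s n≤m) = ≤⇒<ᵇ≡false n≤m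

≤⇒≤ᵇ≡true : {m n : ℕ} → m ≤ n → (m ≤ᵇ n) ≡ true
≤⇒≤ᵇ≡true z≤n       = refl
≤⇒≤ᵇ≡true (s≤s m≤n) = <⇒<ᵇ≡true (s≤s m≤n)

<⇒≤ᵇ≡false : {m n : ℕ} → n < m → (m ≤ᵇ n) ≡ false
<⇒≤ᵇ≡false (s≤s n≤m) = ≤⇒<ᵇ≡false n≤m

<ᵇ≡true⇒< : (m n : ℕ) → (m <ᵇ n) ≡ true → m < n
<ᵇ≡true⇒< zero    (suc n) _  = s≤s z≤n
<ᵇ≡true⇒< (suc m) (suc n) eq = s≤s (<ᵇ≡true⇒< m n eq)

<ᵇ≡false⇒≤ : (m n : ℕ) → (m <ᵇ n) ≡ false → n ≤ m
<ᵇ≡false⇒≤ m       zero    _  = z≤n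
<ᵇ≡false⇒≤ (suc m) (suc n) eq = s≤s (<ᵇ≡false⇒≤ m n eq)

<ᵇ-trans : (β : Bool) {l m n : ℕ} → (l <ᵇ m) ≡ β → (m <ᵇ n) ≡ β → (l <ᵇ n) ≡ β
<ᵇ-trans true  {l} {m} {n} p q = <⇒<ᵇ≡true (ℕₚ.<-trans (<ᵇ≡true⇒< l m p) (<ᵇ≡true⇒< m n q))
<ᵇ-trans false {l} {m} {n} p q = ≤⇒<ᵇ≡false (≤-trans (<ᵇ≡false⇒≤ m n q) (<ᵇ≡false⇒≤ l m p))

<ᵇ-+ˡ : (c m n : ℕ) → (c + m <ᵇ c + n) ≡ (m <ᵇ n)
<ᵇ-+ˡ zero    m n = refl
<ᵇ-+ˡ (suc c) m n = <ᵇ-+ˡ c m n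

_==_ : {n : ℕ} → Fin n → Fin n → Bool
x == e = ⌊ x ≟F e ⌋

==⇒≡ : {n : ℕ} {x e : Fin n} → (x == e) ≡ true → x ≡ e
==⇒≡ {x = x} {e} eq with x ≟F e
... | yes x≡e = x≡e

≡⇒== : {n : ℕ} {x e : Fin n} → x ≡ e → (x == e) ≡ true
≡⇒== {x = x} {e} x≡e with x ≟F e
... | yes _   = refl
... | no x≢e = ⊥-elim (x≢e x≡e)

≢⇒== : {n : ℕ} {x e : Fin n} → x ≢ e → (x == e) ≡ false
≢⇒== {x = x} {e} x≢e with x ≟F e
... | yes x≡e = ⊥-elim (x≢e x≡e)
... | no _    = refl

count : {A : Set} → (A → Bool) → List A → ℕ
count p xs = length (filterᵇ p xs)

module _ {A : Set} (p : A → Bool) where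

  filterᵇ-accept : {x : A} (xs : List A) → p x ≡ true → filterᵇ p (x ∷ xs) ≡ x ∷ filterᵇ p xs
  filterᵇ-accept {x} xs px rewrite px = refl

  filterᵇ-reject : {x : A} (xs : List A) → p x ≡ false → filterᵇ p (x ∷ xs) ≡ filterᵇ p xs
  filterᵇ-reject {x} xs px rewrite px = refl

  filterᵇ-concat : (xss : List (List A)) → filterᵇ p (concat xss) ≡ concat (map (filterᵇ p) xss)
  filterᵇ-concat []         = refl
  filterᵇ-concat (xs ∷ xss) =
    trans (filter-++ (λ x → T? (p x)) xs (concat xss)) (cong (filterᵇ p xs ++_) (filterᵇ-concat xss))

  filterᵇ-none : (∀ x → p x ≡ false) → (xs : List A) → filterᵇ p xs ≡ []
  filterᵇ-none none xs = filter-none (λ x → T? (p x)) (All.universal (λ x → subst T (none x)) xs)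

  count-accept : {x : A} (xs : List A) → p x ≡ true → count p (x ∷ xs) ≡ suc (count p xs)
  count-accept xs px = cong length (filterᵇ-accept xs px)

  count-reject : {x : A} (xs : List A) → p x ≡ false → count p (x ∷ xs) ≡ count p xs
  count-reject xs px = cong length (filterᵇ-reject xs px)

filterᵇ-cong : {A : Set} {p q : A → Bool} → (∀ x → p x ≡ q x) → (xs : List A) → filterᵇ p xs ≡ filterᵇ q xs
filterᵇ-cong {p = p} {q} p≗q =
  filter-≐ (λ x → T? (p x)) (λ x → T? (q x)) ((λ {x} → subst T (p≗q x)) , (λ {x} → subst T (sym (p≗q x))))

filterᵇ-map : {A B : Set} (p : B → Bool) (f : A → B) (xs : List A) →
  filterᵇ p (map f xs) ≡ map f (filterᵇ (λ x → p (f x)) xs)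
filterᵇ-map p f []       = refl
filterᵇ-map p f (x ∷ xs) with p (f x)
... | true  = cong (f x ∷_) (filterᵇ-map p f xs)
... | false = filterᵇ-map p f xs

count-map : {A B : Set} (p : B → Bool) (f : A → B) (xs : List A) → count p (map f xs) ≡ count (λ x → p (f x)) xs
count-map p f xs = trans (cong length (filterᵇ-map p f xs)) (length-map f (filterᵇ (λ x → p (f x)) xs))

count-tabulate : {A : Set} {n : ℕ} (p : A → Bool) (g : Fin n → A) →
  count p (tabulate g) ≡ count (λ o → p (g o)) (allFin n)
count-tabulate {n = n} p g = trans (cong (count p) (sym (map-tabulate (λ o → o) g))) (count-map p g (allFin n))

filterᵇ-tabulate : {A : Set} {n : ℕ} (p : A → Bool) (g : Fin n → A) →
  filterᵇ p (tabulate g) ≡ map g (filterᵇ (λ o → p (g o)) (allFin n))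
filterᵇ-tabulate {n = n} p g = trans (cong (filterᵇ p) (sym (map-tabulate (λ o → o) g))) (filterᵇ-map p g (allFin n))

tabulate-++ : {A : Set} (m n : ℕ) (f : Fin (m + n) → A) →
  tabulate f ≡ tabulate (λ i → f (i ↑ˡ n)) ++ tabulate (λ i → f (m ↑ʳ i))
tabulate-++ zero    n f = refl
tabulate-++ (suc m) n f = cong (f zero ∷_) (tabulate-++ m n (λ i → f (suc i)))

tabulate-combine : {A : Set} (r n : ℕ) (g : Fin (r * n) → A) →
  tabulate g ≡ concat (tabulate {n = r} (λ j → tabulate {n = n} (λ o → g (combine j o))))
tabulate-combine zero    n g = refl
tabulate-combine (suc r) n g =
  trans (tabulate-++ n (r * n) g)
        (cong (tabulate (λ o → g (o ↑ˡ (r * n))) ++_) (tabulate-combine r n (λ v → g (n ↑ʳ v))))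

concat-tabulate-[] : {A : Set} {r : ℕ} (L : Fin r → List A) → (∀ i → L i ≡ []) → concat (tabulate L) ≡ []
concat-tabulate-[] {r = zero}  L empty = refl
concat-tabulate-[] {r = suc r} L empty rewrite empty zero = concat-tabulate-[] (λ i → L (suc i)) (λ i → empty (suc i))

concat-tabulate-single : {A : Set} {r : ℕ} (j : Fin r) (L : Fin r → List A) → (∀ i → i ≢ j → L i ≡ []) →
  concat (tabulate L) ≡ L j
concat-tabulate-single zero    L others =
  trans (cong (L zero ++_) (concat-tabulate-[] (λ i → L (suc i)) (λ i → others (suc i) λ ())))
        (++-identityʳ (L zero))
concat-tabulate-single (suc j) L others rewrite others zero (λ ()) =
  concat-tabulate-single j (λ i → L (suc i)) (λ i i≢j → others (suc i) (λ eq → i≢j (suc-injective eq)))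

length-concat-tabulate : {A : Set} {r : ℕ} (L : Fin r → List A) → (∀ i → length (L i) ≡ 1) →
  length (concat (tabulate L)) ≡ r
length-concat-tabulate {r = zero}  L singletons = refl
length-concat-tabulate {r = suc r} L singletons =
  trans (length-++ (L zero))
        (cong₂ _+_ (singletons zero) (length-concat-tabulate (λ i → L (suc i)) (λ i → singletons (suc i))))

-- Intervals of an r-partite matching

n*i+o<j*n : (n i j o : ℕ) → o < n → i < j → n * i + o < j * n
n*i+o<j*n n i j o o<n i<j = begin-strict
  n * i + o    <⟨ ℕₚ.+-monoʳ-< (n * i) o<n ⟩
  n * i + n    ≡⟨ ℕₚ.+-comm (n * i) n ⟩
  n + n * i    ≡⟨ ℕₚ.*-suc n i ⟨
  n * suc i    ≤⟨ ℕₚ.*-monoʳ-≤ n i<j ⟩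
  n * j        ≡⟨ ℕₚ.*-comm n j ⟩
  j * n        ∎
  where open ℕₚ.≤-Reasoning

[1+j]*n≤n*i+o : (n i j o : ℕ) → j < i → suc j * n ≤ n * i + o
[1+j]*n≤n*i+o n i j o j<i = begin
  suc j * n    ≡⟨ ℕₚ.*-comm (suc j) n ⟩
  n * suc j    ≤⟨ ℕₚ.*-monoʳ-≤ n j<i ⟩
  n * i        ≤⟨ ℕₚ.m≤m+n (n * i) o ⟩
  n * i + o    ∎
  where open ℕₚ.≤-Reasoning

inInterval-combine : {r n : ℕ} (j i : Fin r) (o : Fin n) → inInterval {r} {n} j (combine i o) ≡ (i == j)
inInterval-combine {r} {n} j i o rewrite toℕ-combine i o with ℕₚ.<-cmp (toℕ i) (toℕ j)
... | tri< i<j i≢j _ =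
  trans (cong (_∧ (n * toℕ i + toℕ o <ᵇ suc (toℕ j) * n))
              (<⇒≤ᵇ≡false (n*i+o<j*n n (toℕ i) (toℕ j) (toℕ o) (toℕ<n o) i<j)))
        (sym (≢⇒== (λ eq → i≢j (cong toℕ eq))))
... | tri> _ i≢j j<i =
  trans (cong ((toℕ j * n ≤ᵇ n * toℕ i + toℕ o) ∧_)
              (≤⇒<ᵇ≡false ([1+j]*n≤n*i+o n (toℕ i) (toℕ j) (toℕ o) j<i)))
        (trans (∧-zeroʳ (toℕ j * n ≤ᵇ n * toℕ i + toℕ o)) (sym (≢⇒== (λ eq → i≢j (cong toℕ eq)))))
... | tri≈ _ i≡j _ rewrite i≡j =
  trans (cong₂ _∧_ (≤⇒≤ᵇ≡true (≤-trans (≤-reflexive (ℕₚ.*-comm (toℕ j) n))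
                                        (ℕₚ.m≤m+n (n * toℕ j) (toℕ o))))
                   (<⇒<ᵇ≡true (n*i+o<j*n n (toℕ j) (suc (toℕ j)) (toℕ o) (toℕ<n o) ≤-refl)))
        (sym (≡⇒== (toℕ-injective i≡j)))

edgesIn : {r n : ℕ} → (Fin (r * n) → Fin n) → Fin r → List (Fin n)
edgesIn E j = tabulate (λ o → E (combine j o))

count-inInterval : {r n : ℕ} (E : Fin (r * n) → Fin n) (e : Fin n) (j : Fin r) →
  countᵇ (λ v → (E v == e) ∧ inInterval j v) ≡ count (_== e) (edgesIn E j)
count-inInterval {r} {n} E e j = begin
  count q (allFin (r * n))
    ≡⟨ cong (count q) (tabulate-combine r n (λ v → v)) ⟩
  length (filterᵇ q (concat (tabulate vertices)))
    ≡⟨ cong length (filterᵇ-concat q (tabulate vertices)) ⟩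
  length (concat (map (filterᵇ q) (tabulate vertices)))
    ≡⟨ cong (λ xss → length (concat xss)) (map-tabulate vertices (filterᵇ q)) ⟩
  length (concat (tabulate (λ i → filterᵇ q (vertices i))))
    ≡⟨ cong length (concat-tabulate-single j (λ i → filterᵇ q (vertices i)) otherInterval) ⟩
  count q (vertices j)
    ≡⟨ count-tabulate q (combine j) ⟩
  count (λ o → q (combine j o)) (allFin n)
    ≡⟨ cong length (filterᵇ-cong ownInterval (allFin n)) ⟩
  count (λ o → E (combine j o) == e) (allFin n)
    ≡⟨ count-tabulate (_== e) (λ o → E (combine j o)) ⟨
  count (_== e) (edgesIn E j) ∎
  where
  open ≡-Reasoning
  vertices : Fin r → List (Fin (r * n))
  vertices i = tabulate (combine i)
  q : Fin (r * n) → Bool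
  q v = (E v == e) ∧ inInterval j v
  otherInterval : ∀ i → i ≢ j → filterᵇ q (vertices i) ≡ []
  otherInterval i i≢j = trans (filterᵇ-tabulate q (combine i)) (cong (map (combine i))
    (filterᵇ-none _ (λ o → trans (cong (E (combine i o) == e ∧_) (trans (inInterval-combine j i o) (≢⇒== i≢j)))
                                   (∧-zeroʳ (E (combine i o) == e))) (allFin n)))
  ownInterval : ∀ o → q (combine j o) ≡ (E (combine j o) == e)
  ownInterval o = trans (cong (E (combine j o) == e ∧_) (trans (inInterval-combine j j o) (≡⇒== refl)))
                   (∧-identityʳ (E (combine j o) == e))

count-from-intervals : {r n : ℕ} (E : Fin (r * n) → Fin n) (e : Fin n) →
  (∀ j → count (_== e) (edgesIn E j) ≡ 1) → countᵇ (λ v → E v == e) ≡ r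
count-from-intervals {r} {n} E e once = begin
  count (λ v → E v == e) (allFin (r * n))
    ≡⟨ count-tabulate (_== e) E ⟨
  count (_== e) (tabulate E)
    ≡⟨ cong (count (_== e)) (tabulate-combine r n E) ⟩
  length (filterᵇ (_== e) (concat (tabulate (edgesIn {r} {n} E))))
    ≡⟨ cong length (filterᵇ-concat (_== e) (tabulate (edgesIn {r} {n} E))) ⟩
  length (concat (map (filterᵇ (_== e)) (tabulate (edgesIn {r} {n} E))))
    ≡⟨ cong (λ xss → length (concat xss)) (map-tabulate (edgesIn {r} {n} E) (filterᵇ (_== e))) ⟩
  length (concat (tabulate (λ j → filterᵇ (_== e) (edgesIn {r} {n} E j))))
    ≡⟨ length-concat-tabulate (λ j → filterᵇ (_== e) (edgesIn {r} {n} E j)) once ⟩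
  r ∎
  where open ≡-Reasoning

-- Pair words and positions

indexOf : {n : ℕ} → Fin n → List (Fin n) → ℕ
indexOf e []       = 0
indexOf e (y ∷ ys) = if y == e then 0 else suc (indexOf e ys)

indexOf≤length : {n : ℕ} (e : Fin n) (ys : List (Fin n)) → indexOf e ys ≤ length ys
indexOf≤length e []       = z≤n
indexOf≤length e (y ∷ ys) with y == e
... | true  = z≤n
... | false = s≤s (indexOf≤length e ys)

indexOf-injective : {n : ℕ} {e f : Fin n} (ys : List (Fin n)) → count (_== e) ys ≡ 1 →
  indexOf e ys ≡ indexOf f ys → e ≡ f
indexOf-injective {e = e} {f} (y ∷ ys) once same with y == e in ye | y == f in yf
... | true  | true  = trans (sym (==⇒≡ ye)) (==⇒≡ yf)
... | false | false = indexOf-injective ys once (ℕₚ.suc-injective same)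

block : Bool → List Bool
block β = if β then true ∷ false ∷ [] else false ∷ true ∷ []

pairWord : {n : ℕ} → Fin n → Fin n → List (Fin n) → List Bool
pairWord e f ys = map (_== e) (filterᵇ (λ y → (y == e) ∨ (y == f)) ys)

module _ {n : ℕ} {e f : Fin n} where

  pairWord-∅ : (ys : List (Fin n)) → count (_== e) ys ≡ 0 → count (_== f) ys ≡ 0 → pairWord e f ys ≡ []
  pairWord-∅ []       _  _  = refl
  pairWord-∅ (y ∷ ys) ce cf with y == e | y == f
  ... | false | false = pairWord-∅ ys ce cf

  pairWord-onlyʳ : (ys : List (Fin n)) → count (_== e) ys ≡ 0 → count (_== f) ys ≡ 1 → pairWord e f ys ≡ false ∷ []
  pairWord-onlyʳ (y ∷ ys) ce cf with y == e in ye | y == f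
  ... | false | true  = cong₂ _∷_ ye (pairWord-∅ ys ce (ℕₚ.suc-injective cf))
  ... | false | false = pairWord-onlyʳ ys ce cf

  pairWord-onlyˡ : (ys : List (Fin n)) → count (_== e) ys ≡ 1 → count (_== f) ys ≡ 0 → pairWord e f ys ≡ true ∷ []
  pairWord-onlyˡ (y ∷ ys) ce cf with y == e in ye | y == f
  ... | true  | false = cong₂ _∷_ ye (pairWord-∅ ys (ℕₚ.suc-injective ce) cf)
  ... | false | false = pairWord-onlyˡ ys ce cf

  pairWord-once : e ≢ f → (ys : List (Fin n)) → count (_== e) ys ≡ 1 → count (_== f) ys ≡ 1 →
    pairWord e f ys ≡ block (indexOf e ys <ᵇ indexOf f ys)
  pairWord-once e≢f (y ∷ ys) ce cf with y == e in ye | y == f in yf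
  ... | true  | true  = ⊥-elim (e≢f (trans (sym (==⇒≡ ye)) (==⇒≡ yf)))
  ... | true  | false = cong₂ _∷_ ye (pairWord-onlyʳ ys (ℕₚ.suc-injective ce) cf)
  ... | false | true  = cong₂ _∷_ ye (pairWord-onlyˡ ys ce (ℕₚ.suc-injective cf))
  ... | false | false = pairWord-once e≢f ys ce cf

tabulate-injective : {A : Set} {n : ℕ} {f g : Fin n → A} → tabulate f ≡ tabulate g → ∀ i → f i ≡ g i
tabulate-injective {n = suc n} eq zero    = proj₁ (∷-injective eq)
tabulate-injective {n = suc n} eq (suc i) = tabulate-injective (proj₂ (∷-injective eq)) i

tabulate-lookup≡toList : {A : Set} {k : ℕ} (v : Vec A k) → tabulate (lookup v) ≡ toList v
tabulate-lookup≡toList []      = refl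
tabulate-lookup≡toList (x ∷ v) = cong (x ∷_) (tabulate-lookup≡toList v)

concat-map-block-injective : (xs ys : List Bool) → concat (map block xs) ≡ concat (map block ys) → xs ≡ ys
concat-map-block-injective []          []          _  = refl
concat-map-block-injective (true ∷ xs) (true ∷ ys) eq =
  cong (true ∷_) (concat-map-block-injective xs ys (proj₂ (∷-injective (proj₂ (∷-injective eq)))))
concat-map-block-injective (false ∷ xs) (false ∷ ys) eq =
  cong (false ∷_) (concat-map-block-injective xs ys (proj₂ (∷-injective (proj₂ (∷-injective eq)))))
concat-map-block-injective []           (true ∷ _)  ()
concat-map-block-injective []           (false ∷ _) ()
concat-map-block-injective (true ∷ _)   []          ()
concat-map-block-injective (false ∷ _)  []          ()
concat-map-block-injective (true ∷ _)   (false ∷ _) ()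
concat-map-block-injective (false ∷ _)  (true ∷ _)  ()

pairWord-concat : {n : ℕ} (e f : Fin n) (yss : List (List (Fin n))) →
  pairWord e f (concat yss) ≡ concat (map (pairWord e f) yss)
pairWord-concat {n} e f yss = begin
  map (_== e) (filterᵇ p (concat yss))                 ≡⟨ cong (map (_== e)) (filterᵇ-concat p yss) ⟩
  map (_== e) (concat (map (filterᵇ p) yss))           ≡⟨ concat-map (map (filterᵇ p) yss) ⟨
  concat (map (map (_== e)) (map (filterᵇ p) yss))     ≡⟨ cong concat (map-∘ yss) ⟨
  concat (map (pairWord e f) yss)                      ∎
  where
  open ≡-Reasoning
  p : Fin n → Bool
  p y = (y == e) ∨ (y == f)

word≡pairWord : {r n : ℕ} (M : OrderedMatching r n) (e f : Fin n) → word M e f ≡ pairWord e f (tabulate (edgeOf M))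
word≡pairWord {r} {n} M e f = begin
  map (λ v → edgeOf M v == e) (filterᵇ (λ v → p (edgeOf M v)) (allFin (r * n)))
    ≡⟨ map-∘ (filterᵇ (λ v → p (edgeOf M v)) (allFin (r * n))) ⟩
  map (_== e) (map (edgeOf M) (filterᵇ (λ v → p (edgeOf M v)) (allFin (r * n))))
    ≡⟨ cong (map (_== e)) (filterᵇ-tabulate p (edgeOf M)) ⟨
  pairWord e f (tabulate (edgeOf M)) ∎
  where
  open ≡-Reasoning
  p : Fin n → Bool
  p y = (y == e) ∨ (y == f)

Precedes : {k : ℕ} {X : Set} → (Fin (suc k) → X → ℕ) → Vec Bool k → X → X → Set
Precedes pos b e f = ∀ j → (pos j e <ᵇ pos j f) ≡ lookup (true ∷ b) j

module PrecedesOrder {k : ℕ} {X : Set} (pos : Fin (suc k) → X → ℕ) where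

  precedes⇒pos₀< : ∀ {b e f} → Precedes pos b e f → pos zero e < pos zero f
  precedes⇒pos₀< {e = e} {f} e≺f = <ᵇ≡true⇒< (pos zero e) (pos zero f) (e≺f zero)

  precedes⇒≢ : ∀ {b e f} → Precedes pos b e f → e ≢ f
  precedes⇒≢ e≺f refl = <-irrefl refl (precedes⇒pos₀< e≺f)

  precedes-trans : ∀ {b e f g} → Precedes pos b e f → Precedes pos b f g → Precedes pos b e g
  precedes-trans {e = e} {f} {g} e≺f f≺g j = <ᵇ-trans _ {pos j e} {pos j f} {pos j g} (e≺f j) (f≺g j)

module PartitePositions {k n : ℕ} (M : OrderedMatching (suc k) n)
  (once : ∀ e j → count (_== e) (edgesIn {suc k} {n} (edgeOf M) j) ≡ 1) where

  edgeOrder : Fin (suc k) → List (Fin n)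
  edgeOrder = edgesIn {suc k} {n} (edgeOf M)

  position : Fin (suc k) → Fin n → ℕ
  position j e = indexOf e (edgeOrder j)

  position-injective : ∀ j {e f} → position j e ≡ position j f → e ≡ f
  position-injective j {e} same = indexOf-injective (edgeOrder j) (once e j) same

  position≤n : ∀ j e → position j e ≤ n
  position≤n j e = ≤-trans (indexOf≤length e (edgeOrder j)) (≤-reflexive (length-tabulate _))

  word-positions : {e f : Fin n} → e ≢ f →
    word M e f ≡ concat (map block (tabulate (λ j → position j e <ᵇ position j f)))
  word-positions {e} {f} e≢f = begin
    word M e f
      ≡⟨ word≡pairWord M e f ⟩
    pairWord e f (tabulate (edgeOf M))
      ≡⟨ cong (pairWord e f) (tabulate-combine (suc k) n (edgeOf M)) ⟩
    pairWord e f (concat (tabulate edgeOrder))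
      ≡⟨ pairWord-concat e f (tabulate edgeOrder) ⟩
    concat (map (pairWord e f) (tabulate edgeOrder))
      ≡⟨ cong concat (map-tabulate edgeOrder (pairWord e f)) ⟩
    concat (tabulate (λ j → pairWord e f (edgeOrder j)))
      ≡⟨ cong concat (tabulate-cong (λ j → pairWord-once e≢f (edgeOrder j) (once e j) (once f j))) ⟩
    concat (tabulate (λ j → block (position j e <ᵇ position j f)))
      ≡⟨ cong concat (map-tabulate (λ j → position j e <ᵇ position j f) block) ⟨
    concat (map block (tabulate (λ j → position j e <ᵇ position j f))) ∎
    where open ≡-Reasoning

  word≡pattern⇔precedes : {e f : Fin n} → e ≢ f → (b : Vec Bool k) →
    word M e f ≡ partitePattern b ⇔ Precedes position b e f
  word≡pattern⇔precedes {e} {f} e≢f b = mk⇔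
    (λ w → tabulate-injective (trans (concat-map-block-injective _ _ (trans (sym (word-positions e≢f)) w))
                                     (sym (tabulate-lookup≡toList (true ∷ b)))))
    (λ prec → trans (word-positions e≢f)
                    (cong (λ bs → concat (map block bs)) (trans (tabulate-cong prec) (tabulate-lookup≡toList (true ∷ b)))))

AllPairs-related : {A : Set} {R : A → A → Set} {xs : List A} → AllPairs R xs →
  {y z : A} → y ∈ₗ xs → z ∈ₗ xs → y ≢ z → R y z ⊎ R z y
AllPairs-related (_   ∷ _)   (here refl) (here refl) y≢z = ⊥-elim (y≢z refl)
AllPairs-related (Rx ∷ _)   (here refl) (there z∈)  _   = inj₁ (All-lookup Rx z∈)
AllPairs-related (Rx ∷ _)   (there y∈)  (here refl) _   = inj₂ (All-lookup Rx y∈)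
AllPairs-related (_  ∷ Rxs) (there y∈)  (there z∈)  y≢z = AllPairs-related Rxs y∈ z∈ y≢z

toSubset : {n : ℕ} → List (Fin n) → Subset n
toSubset xs = ⋃ (map ⁅_⁆ xs)

∈-toSubset⁻ : {n : ℕ} (xs : List (Fin n)) {y : Fin n} → y ∈ₛ toSubset xs → y ∈ₗ xs
∈-toSubset⁻ []       y∈ = ⊥-elim (∉⊥ y∈)
∈-toSubset⁻ (x ∷ xs) y∈ with x∈p∪q⁻ ⁅ x ⁆ (toSubset xs) y∈
... | inj₁ y∈⁅x⁆ = here (x∈⁅y⁆⇒x≡y x y∈⁅x⁆)
... | inj₂ y∈xs  = there (∈-toSubset⁻ xs y∈xs)

length≤∣toSubset∣ : {n : ℕ} {xs : List (Fin n)} → Unique xs → length xs ≤ ∣ toSubset xs ∣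
length≤∣toSubset∣ {xs = []}     []           = z≤n
length≤∣toSubset∣ {xs = x ∷ xs} (x∉xs ∷ uxs) = <-≤-trans (s≤s (length≤∣toSubset∣ uxs))
  (p⊂q⇒∣p∣<∣q∣ (q⊆p∪q ⁅ x ⁆ (toSubset xs) , x , x∈p∪q⁺ (inj₁ (x∈⁅x⁆ x)) ,
                λ x∈xs → All-lookup x∉xs (∈-toSubset⁻ xs x∈xs) refl))

encode : (k : ℕ) (a : Vec Bool k → ℕ) → ((b : Vec Bool k) → Fin (a b)) → Fin (prodAll k a)
encode zero    a L = L []
encode (suc k) a L = combine (encode k (λ b → a (true ∷ b)) (λ b → L (true ∷ b)))
                             (encode k (λ b → a (false ∷ b)) (λ b → L (false ∷ b)))

encode-injective : (k : ℕ) (a : Vec Bool k → ℕ) {L L′ : (b : Vec Bool k) → Fin (a b)} →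
  encode k a L ≡ encode k a L′ → ∀ b → L b ≡ L′ b
encode-injective zero    a eq [] = eq
encode-injective (suc k) a {L} {L′} eq (β ∷ b) with Finₚ.combine-injective
  (encode k _ (λ b → L (true ∷ b))) (encode k _ (λ b → L (false ∷ b)))
  (encode k _ (λ b → L′ (true ∷ b))) (encode k _ (λ b → L′ (false ∷ b))) eq
... | eqᵗ , eqᶠ with β
...   | true  = encode-injective k _ eqᵗ b
...   | false = encode-injective k _ eqᶠ b

-- Chains and the upper bound

m⊓n∸1<n : (m : ℕ) {n : ℕ} → 1 ≤ n → (m ⊓ n) ∸ 1 < n
m⊓n∸1<n m {suc n} _ = s≤s (ℕₚ.∸-monoˡ-≤ 1 (ℕₚ.m⊓n≤n m (suc n)))

module ChainBound {k n : ℕ} (pos : Fin (suc k) → Fin n → ℕ)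
  (pos-injective : ∀ j {e f} → pos j e ≡ pos j f → e ≡ f) (pos₀≤n : ∀ e → pos zero e ≤ n) where

  open PrecedesOrder pos public

  Descending : Vec Bool k → List (Fin n) → Set
  Descending b = AllPairs (λ x y → Precedes pos b y x)

  precedes? : ∀ b e f → Dec (Precedes pos b e f)
  precedes? b e f = Finₚ.all? (λ j → (pos j e <ᵇ pos j f) Boolₚ.≟ lookup (true ∷ b) j)

  precedes-total : ∀ {e f} → e ≢ f → Σ (Vec Bool k) λ b → Precedes pos b e f ⊎ Precedes pos b f e
  precedes-total {e} {f} e≢f with pos zero e <ᵇ pos zero f in e<f
  ... | true  = Vec.tabulate (λ j → pos (suc j) e <ᵇ pos (suc j) f) , inj₁ e≺f
    where
    e≺f : Precedes pos _ e f
    e≺f zero    = e<f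
    e≺f (suc j) = sym (lookup∘tabulate (λ j → pos (suc j) e <ᵇ pos (suc j) f) j)
  ... | false = Vec.tabulate (λ j → pos (suc j) f <ᵇ pos (suc j) e) , inj₂ f≺e
    where
    f≺e : Precedes pos _ f e
    f≺e zero    =
      <⇒<ᵇ≡true (ℕₚ.≤∧≢⇒< (<ᵇ≡false⇒≤ _ _ e<f) (λ same → e≢f (pos-injective zero (sym same))))
    f≺e (suc j) = sym (lookup∘tabulate (λ j → pos (suc j) f <ᵇ pos (suc j) e) j)

  module _ (b : Vec Bool k) where

    predecessors : Fin n → List (Fin n)
    predecessors e = filter (λ f → precedes? b f e) (allFin n)

    -- A descending chain strictly decreases pos zero, so the recursion reaches its fixed point
    -- after suc (pos zero e) rounds; suc n rounds suffice for every e.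
    heightWithin : ℕ → Fin n → ℕ
    heightWithin zero    e = 0
    heightWithin (suc m) e = suc (max 0 (map (heightWithin m) (predecessors e)))

    height : Fin n → ℕ
    height = heightWithin (suc n)

    heightWithin-stable : ∀ m e → pos zero e < m → heightWithin m e ≡ heightWithin (suc m) e
    heightWithin-stable (suc m) e pos<m = cong (λ hs → suc (max 0 hs)) (map-cong-local (All.tabulate stable))
      where
      stable : ∀ {f} → f ∈ₗ predecessors e → heightWithin m f ≡ heightWithin (suc m) f
      stable f∈ = heightWithin-stable m _
        (<-≤-trans (precedes⇒pos₀< (proj₂ (∈-filter⁻ (λ f → precedes? b f e) {xs = allFin n} f∈)))
                   (ℕₚ.≤-pred pos<m))

    precedes⇒height< : ∀ {f e} → Precedes pos b f e → height f < height e
    precedes⇒height< {f} {e} f≺e = begin-strict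
      height f         <⟨ s≤s (All-lookup (xs≤max 0 hs) (∈-map⁺ (heightWithin (suc n)) f∈)) ⟩
      suc (max 0 hs)   ≡⟨ heightWithin-stable (suc n) e (s≤s (pos₀≤n e)) ⟨
      height e         ∎
      where
      open ℕₚ.≤-Reasoning
      hs : List ℕ
      hs = map (heightWithin (suc n)) (predecessors e)
      f∈ : f ∈ₗ predecessors e
      f∈ = ∈-filter⁺ (λ f → precedes? b f e) (∈-allFin f) f≺e

    descendingChain : ∀ m e → Σ (List (Fin n)) λ c → Descending b (e ∷ c) × heightWithin m e ≤ length (e ∷ c)
    descendingChain zero    e = [] , ([] ∷ []) , z≤n
    descendingChain (suc m) e with argmax-sel (λ h → h) 0 (map (heightWithin m) (predecessors e))
    ... | inj₁ max≡0 = [] , ([] ∷ []) , s≤s (≤-reflexive max≡0)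
    ... | inj₂ max∈ with ∈-map⁻ (heightWithin m) max∈
    ...   | f , f∈ , max≡ with descendingChain m f
    ...     | c , (c≺f ∷ desc) , long =
      f ∷ c , ((f≺e ∷ All-map (λ g≺f → precedes-trans g≺f f≺e) c≺f) ∷ c≺f ∷ desc)
            , s≤s (≤-trans (≤-reflexive max≡) long)
      where
      f≺e : Precedes pos b f e
      f≺e = proj₂ (∈-filter⁻ (λ f → precedes? b f e) {xs = allFin n} f∈)

  module _ (a : Vec Bool k → ℕ) (a≥1 : ∀ b → 1 ≤ a b) where

    level : (b : Vec Bool k) → Fin n → Fin (a b)
    level b e = fromℕ< (m⊓n∸1<n (height b e) (a≥1 b))

    sameLevel⇒tall : ∀ {b x y} → Precedes pos b x y → level b x ≡ level b y → a b < height b y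
    sameLevel⇒tall {b} {x} {y} x≺y same with a b ℕₚ.<? height b y
    ... | yes tall = tall
    -- Heights are successors by definition, so ∸ 1 is cancelled by ≤-pred and by suc.
    ... | no ¬tall = ⊥-elim (<-irrefl heights-agree (ℕₚ.≤-pred (precedes⇒height< b x≺y)))
      where
      y-short : height b y ≤ a b
      y-short = ℕₚ.≮⇒≥ ¬tall
      x-short : height b x ≤ a b
      x-short = ≤-trans (ℕₚ.<⇒≤ (precedes⇒height< b x≺y)) y-short
      heights-agree : height b x ∸ 1 ≡ height b y ∸ 1
      heights-agree = begin
        height b x ∸ 1           ≡⟨ cong (_∸ 1) (ℕₚ.m≤n⇒m⊓n≡m x-short) ⟨
        (height b x ⊓ a b) ∸ 1   ≡⟨ Finₚ.toℕ-fromℕ< _ ⟨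
        toℕ (level b x)          ≡⟨ cong toℕ same ⟩
        toℕ (level b y)          ≡⟨ Finₚ.toℕ-fromℕ< _ ⟩
        (height b y ⊓ a b) ∸ 1   ≡⟨ cong (_∸ 1) (ℕₚ.m≤n⇒m⊓n≡m y-short) ⟩
        height b y ∸ 1           ∎
        where open ≡-Reasoning

    LongChain : Set
    LongChain = Σ (Vec Bool k) λ b → Σ (List (Fin n)) λ c → Descending b c × a b < length c

    tall⇒longChain : ∀ b e → a b < height b e → LongChain
    tall⇒longChain b e tall with descendingChain b (suc n) e
    ... | c , desc , long = b , e ∷ c , desc , <-≤-trans tall long

    longChain : prodAll k a < n → LongChain
    longChain many with Finₚ.pigeonhole many (λ e → encode k a (λ b → level b e))
    ... | x , y , x<y , sameCode with precedes-total {x} {y} (λ x≡y → <-irrefl (cong toℕ x≡y) x<y)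
    ...   | b , inj₁ x≺y = tall⇒longChain b y (sameLevel⇒tall x≺y (encode-injective k a sameCode b))
    ...   | b , inj₂ y≺x = tall⇒longChain b x (sameLevel⇒tall y≺x (sym (encode-injective k a sameCode b)))

partite⇒once : {r n : ℕ} (M : PartiteMatching r n) → ∀ e j → count (_== e) (edgesIn (edgeOf (proj₁ M)) j) ≡ 1
partite⇒once (M , partite) e j = trans (sym (count-inInterval (edgeOf M) e j)) (partite e j)

module PartiteChains {k n : ℕ} (M : PartiteMatching (suc k) n) where
  open PartitePositions (proj₁ M) (partite⇒once M) public
  open ChainBound position position-injective (position≤n zero) public

  descending⇒clique : ∀ {b c} → Descending b c → IsClique (proj₁ M) (partitePattern b) (toSubset c)
  descending⇒clique {b} {c} desc e f e∈ f∈ e≢f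
    with AllPairs-related desc (∈-toSubset⁻ c e∈) (∈-toSubset⁻ c f∈) e≢f
  ... | inj₁ f≺e = inj₂ (Equivalence.from (word≡pattern⇔precedes (λ f≡e → e≢f (sym f≡e)) b) f≺e)
  ... | inj₂ e≺f = inj₁ (Equivalence.from (word≡pattern⇔precedes e≢f b) e≺f)

  descending⇒unique : ∀ {b c} → Descending b c → Unique c
  descending⇒unique = AllPairs.map (λ y≺x x≡y → precedes⇒≢ y≺x (sym x≡y))

largeClique : (k : ℕ) (a : Vec Bool k → ℕ) → (∀ b → 1 ≤ a b) →
  (n : ℕ) → suc (prodAll k a) ≤ n → (M : PartiteMatching (suc k) n) →
  Σ (Vec Bool k) λ b → Σ (Subset n) λ S → IsClique (proj₁ M) (partitePattern b) S × suc (a b) ≤ ∣ S ∣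
largeClique k a a≥1 n many M = cliqueOf (longChain a a≥1 many)
  where
  open PartiteChains M
  cliqueOf : LongChain a a≥1 →
    Σ (Vec Bool k) λ b → Σ (Subset n) λ S → IsClique (proj₁ M) (partitePattern b) S × suc (a b) ≤ ∣ S ∣
  cliqueOf (b , c , desc , long) =
    b , toSubset c , descending⇒clique desc , ≤-trans long (length≤∣toSubset∣ (descending⇒unique desc))

-- The product construction and the lower bound

injectiveOn⇒∣p∣≤∣q∣ : {n m : ℕ} (p : Subset n) (q : Subset m) (f : Fin n → Fin m) →
  (∀ {x} → x ∈ₛ p → f x ∈ₛ q) → (∀ {x y} → x ∈ₛ p → y ∈ₛ p → f x ≡ f y → x ≡ y) →
  ∣ p ∣ ≤ ∣ q ∣
injectiveOn⇒∣p∣≤∣q∣ []            q f into inj = z≤n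
injectiveOn⇒∣p∣≤∣q∣ (outside ∷ p) q f into inj =
  injectiveOn⇒∣p∣≤∣q∣ p q (λ x → f (suc x)) (λ x∈ → into (thereₛ x∈))
    (λ x∈ y∈ same → suc-injective (inj (thereₛ x∈) (thereₛ y∈) same))
injectiveOn⇒∣p∣≤∣q∣ (inside ∷ p)  q f into inj = <-≤-trans
  (s≤s (injectiveOn⇒∣p∣≤∣q∣ p (q - f zero) (λ x → f (suc x))
    (λ x∈ → x∈p∧x≢y⇒x∈p-y (into (thereₛ x∈)) (λ same → 0≢1+n (inj hereₛ (thereₛ x∈) (sym same))))
    (λ x∈ y∈ same → suc-injective (inj (thereₛ x∈) (thereₛ y∈) same))))
  (x∈p⇒∣p-x∣<∣p∣ (into hereₛ))

count-tabulate-unique : {A : Set} {n : ℕ} (p : A → Bool) (g : Fin n → A) {t : Fin n} →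
  p (g t) ≡ true → (∀ o → p (g o) ≡ true → o ≡ t) → count p (tabulate g) ≡ 1
count-tabulate-unique {n = suc n} p g {zero} pt unique = begin
  count p (tabulate g)                           ≡⟨ count-accept p _ pt ⟩
  suc (count p (tabulate (λ o → g (suc o))))     ≡⟨ cong suc (count-tabulate p (λ o → g (suc o))) ⟩
  suc (count (λ o → p (g (suc o))) (allFin n))   ≡⟨ cong (λ xs → suc (length xs)) (filterᵇ-none _ rest (allFin n)) ⟩
  1                                              ∎
  where
  open ≡-Reasoning
  rest : ∀ o → p (g (suc o)) ≡ false
  rest o = Boolₚ.¬-not (λ po → 0≢1+n (sym (unique (suc o) po)))
count-tabulate-unique p g {suc t} pt unique = trans (count-reject p _ (Boolₚ.¬-not (λ p0 → 0≢1+n (unique zero p0))))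
  (count-tabulate-unique p (λ o → g (suc o)) pt (λ o po → suc-injective (unique (suc o) po)))

indexOf-tabulate-unique : {n m : ℕ} (g : Fin n → Fin m) {e : Fin m} {t : Fin n} →
  g t ≡ e → (∀ o → g o ≡ e → o ≡ t) → indexOf e (tabulate g) ≡ toℕ t
indexOf-tabulate-unique g {t = zero}  gt≡e unique rewrite ≡⇒== gt≡e = refl
indexOf-tabulate-unique g {t = suc t} gt≡e unique rewrite ≢⇒== (λ g0≡e → 0≢1+n (unique zero g0≡e)) =
  cong suc (indexOf-tabulate-unique (λ o → g (suc o)) gt≡e (λ o go≡e → suc-injective (unique (suc o) go≡e)))

<ᵇ-combine-≢ : {m n : ℕ} {u u′ : Fin m} (v v′ : Fin n) → u ≢ u′ →
  (toℕ (combine u v) <ᵇ toℕ (combine u′ v′)) ≡ (toℕ u <ᵇ toℕ u′)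
<ᵇ-combine-≢ {u = u} {u′} v v′ u≢u′ with ℕₚ.<-cmp (toℕ u) (toℕ u′)
... | tri< u<u′ _ _ = trans (<⇒<ᵇ≡true (Finₚ.combine-monoˡ-< v v′ u<u′)) (sym (<⇒<ᵇ≡true u<u′))
... | tri≈ _ u≡u′ _ = ⊥-elim (u≢u′ (toℕ-injective u≡u′))
... | tri> _ _ u′<u =
  trans (≤⇒<ᵇ≡false (ℕₚ.<⇒≤ (Finₚ.combine-monoˡ-< v′ v u′<u))) (sym (≤⇒<ᵇ≡false (ℕₚ.<⇒≤ u′<u)))

<ᵇ-combine-≡ : {m n : ℕ} {u u′ : Fin m} (v v′ : Fin n) → u ≡ u′ →
  (toℕ (combine u v) <ᵇ toℕ (combine u′ v′)) ≡ (toℕ v <ᵇ toℕ v′)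
<ᵇ-combine-≡ {n = n} {u} v v′ refl rewrite toℕ-combine u v | toℕ-combine u v′ =
  <ᵇ-+ˡ (n * toℕ u) (toℕ v) (toℕ v′)

<ᵇ-opposite : {n : ℕ} (x y : Fin n) → (toℕ (opposite x) <ᵇ toℕ (opposite y)) ≡ (toℕ y <ᵇ toℕ x)
<ᵇ-opposite {n} x y rewrite Finₚ.opposite-prop x | Finₚ.opposite-prop y with ℕₚ.<-cmp (toℕ x) (toℕ y)
... | tri< x<y _ _ =
  trans (≤⇒<ᵇ≡false (ℕₚ.<⇒≤ (ℕₚ.∸-monoʳ-< {n} (s≤s x<y) (toℕ<n y)))) (sym (≤⇒<ᵇ≡false (ℕₚ.<⇒≤ x<y)))
... | tri≈ _ x≡y _ rewrite x≡y =
  trans (≤⇒<ᵇ≡false (≤-refl {n ∸ suc (toℕ y)})) (sym (≤⇒<ᵇ≡false (≤-refl {toℕ y})))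
... | tri> _ _ y<x =
  trans (<⇒<ᵇ≡true (ℕₚ.∸-monoʳ-< {n} (s≤s y<x) (toℕ<n x))) (sym (<⇒<ᵇ≡true y<x))

_⊗_ : {m n : ℕ} → Permutation′ m → Permutation′ n → Permutation′ (m * n)
_⊗_ {m} {n} π ρ = ↔-trans (*↔× {m} {n}) (↔-trans (π ×-↔ ρ) (↔-sym *↔×))

rank : {k N : ℕ} → (Fin (suc k) → Permutation′ N) → Fin (suc k) → Fin N → ℕ
rank π j x = toℕ (π j ⟨$⟩ʳ x)

record PatternColouring (k : ℕ) (a : Vec Bool k → ℕ) : Set where
  field
    order  : Fin (suc k) → Permutation′ (prodAll k a)
    colour : (b : Vec Bool k) → Fin (prodAll k a) → Fin (a b)
    proper : ∀ b {x y} → Precedes (rank order) b x y → colour b x ≢ colour b y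
open PatternColouring

trivialColouring : (a : Vec Bool 0 → ℕ) → PatternColouring 0 a
trivialColouring a = record
  { order  = λ _ → idₚ
  ; colour = λ { [] x → x }
  ; proper = λ { [] → PrecedesOrder.precedes⇒≢ (rank (λ _ → idₚ)) }
  }

module ProductColouring {k : ℕ} {a : Vec Bool (suc k) → ℕ}
  (A : PatternColouring k (λ b → a (true ∷ b))) (B : PatternColouring k (λ b → a (false ∷ b))) where

  NA NB : ℕ
  NA = prodAll k (λ b → a (true ∷ b))
  NB = prodAll k (λ b → a (false ∷ b))

  first : Fin (NA * NB) → Fin NA
  first x = proj₁ (remQuot {NA} NB x)

  second : Fin (NA * NB) → Fin NB
  second x = proj₂ (remQuot {NA} NB x)

  -- Order 1 reverses the second factor of order 0, so the letter at block 1 of the pattern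
  -- records whether two elements differ in the first factor or only in the second.
  orders : Fin (suc (suc k)) → Permutation′ (NA * NB)
  orders zero          = order A zero ⊗ order B zero
  orders (suc zero)    = order A zero ⊗ (order B zero ∘ₚ reverse)
  orders (suc (suc j)) = order A (suc j) ⊗ order B (suc j)

  colours : (b : Vec Bool (suc k)) → Fin (NA * NB) → Fin (a b)
  colours (true ∷ b)  x = colour A b (first x)
  colours (false ∷ b) x = colour B b (second x)

  precedes-first : ∀ {β b x y} → first x ≢ first y → Precedes (rank orders) (β ∷ b) x y →
    β ≡ true × Precedes (rank (order A)) b (first x) (first y)
  precedes-first {β} {b} {x} {y} x≢y x≺y = β≡true , x≺ᴬy
    where
    apart : ∀ j → order A j ⟨$⟩ʳ first x ≢ order A j ⟨$⟩ʳ first y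
    apart j same = x≢y (Injection.injective (↔⇒↣ (order A j)) same)
    x≺ᴬy : Precedes (rank (order A)) b (first x) (first y)
    x≺ᴬy zero    = trans (sym (<ᵇ-combine-≢ _ _ (apart zero))) (x≺y zero)
    x≺ᴬy (suc j) = trans (sym (<ᵇ-combine-≢ _ _ (apart (suc j)))) (x≺y (suc (suc j)))
    β≡true : β ≡ true
    β≡true = trans (sym (x≺y (suc zero))) (trans (<ᵇ-combine-≢ _ _ (apart zero)) (x≺ᴬy zero))

  precedes-second : ∀ {β b x y} → first x ≡ first y → Precedes (rank orders) (β ∷ b) x y →
    β ≡ false × Precedes (rank (order B)) b (second x) (second y)
  precedes-second {β} {b} {x} {y} x≡y x≺y = β≡false , x≺ᴮy
    where
    same : ∀ j → order A j ⟨$⟩ʳ first x ≡ order A j ⟨$⟩ʳ first y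
    same j = cong (order A j ⟨$⟩ʳ_) x≡y
    x≺ᴮy : Precedes (rank (order B)) b (second x) (second y)
    x≺ᴮy zero    = trans (sym (<ᵇ-combine-≡ _ _ (same zero))) (x≺y zero)
    x≺ᴮy (suc j) = trans (sym (<ᵇ-combine-≡ _ _ (same (suc j)))) (x≺y (suc (suc j)))
    β≡false : β ≡ false
    β≡false = begin
      β
        ≡⟨ x≺y (suc zero) ⟨
      rank orders (suc zero) x <ᵇ rank orders (suc zero) y
        ≡⟨ <ᵇ-combine-≡ _ _ (same zero) ⟩
      toℕ (opposite (order B zero ⟨$⟩ʳ second x)) <ᵇ toℕ (opposite (order B zero ⟨$⟩ʳ second y))
        ≡⟨ <ᵇ-opposite (order B zero ⟨$⟩ʳ second x) (order B zero ⟨$⟩ʳ second y) ⟩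
      rank (order B) zero (second y) <ᵇ rank (order B) zero (second x)
        ≡⟨ ≤⇒<ᵇ≡false (ℕₚ.<⇒≤ x<ᴮy) ⟩
      false ∎
      where
      open ≡-Reasoning
      x<ᴮy : rank (order B) zero (second x) < rank (order B) zero (second y)
      x<ᴮy = <ᵇ≡true⇒< _ _ (x≺ᴮy zero)

  proper-product : ∀ b {x y} → Precedes (rank orders) b x y → colours b x ≢ colours b y
  proper-product (true ∷ b) {x} {y} x≺y with first x ≟F first y
  ... | no  x≢y = proper A b (proj₂ (precedes-first x≢y x≺y))
  ... | yes x≡y with () ← proj₁ (precedes-second x≡y x≺y)
  proper-product (false ∷ b) {x} {y} x≺y with first x ≟F first y
  ... | no  x≢y with () ← proj₁ (precedes-first x≢y x≺y)
  ... | yes x≡y = proper B b (proj₂ (precedes-second x≡y x≺y))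

  productColouring : PatternColouring (suc k) a
  productColouring = record { order = orders ; colour = colours ; proper = proper-product }

patternColouring : (k : ℕ) (a : Vec Bool k → ℕ) → PatternColouring k a
patternColouring zero    a = trivialColouring a
patternColouring (suc k) a = ProductColouring.productColouring
  (patternColouring k (λ b → a (true ∷ b))) (patternColouring k (λ b → a (false ∷ b)))

module OrderMatching {k N : ℕ} (π : Fin (suc k) → Permutation′ N) where

  -- Offset o of interval j lies on edge π j ⁻¹ o, so edge e sits at offset π j e of interval j.

  edge : Fin (suc k * N) → Fin N
  edge v = π (proj₁ (remQuot {suc k} N v)) ⟨$⟩ˡ proj₂ (remQuot {suc k} N v)

  edgesIn-edge : ∀ j → edgesIn edge j ≡ tabulate (π j ⟨$⟩ˡ_)
  edgesIn-edge j = tabulate-cong (λ o → cong (λ (j , o) → π j ⟨$⟩ˡ o) (Finₚ.remQuot-combine j o))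

  preimage-unique : ∀ j {e} o → π j ⟨$⟩ˡ o ≡ e → o ≡ π j ⟨$⟩ʳ e
  preimage-unique j o refl = sym (inverseʳ (π j))

  once : ∀ e j → count (_== e) (edgesIn edge j) ≡ 1
  once e j = trans (cong (count (_== e)) (edgesIn-edge j))
    (count-tabulate-unique (_== e) (π j ⟨$⟩ˡ_) (≡⇒== (inverseˡ (π j)))
      (λ o hit → preimage-unique j o (==⇒≡ hit)))

  matching : PartiteMatching (suc k) N
  matching = record { edgeOf = edge ; edgeSize = λ e → count-from-intervals edge e (once e) }
           , λ e j → trans (count-inInterval edge e j) (once e j)

  open PartitePositions (proj₁ matching) once

  position≡rank : ∀ j e → position j e ≡ rank π j e
  position≡rank j e = trans (cong (indexOf e) (edgesIn-edge j))
    (indexOf-tabulate-unique (π j ⟨$⟩ˡ_) (inverseˡ (π j)) (preimage-unique j))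

  word≡pattern⇒precedes : ∀ {b e f} → e ≢ f → word (proj₁ matching) e f ≡ partitePattern b →
    Precedes (rank π) b e f
  word≡pattern⇒precedes {b} {e} {f} e≢f w j =
    trans (sym (cong₂ _<ᵇ_ (position≡rank j e) (position≡rank j f)))
          (Equivalence.to (word≡pattern⇔precedes e≢f b) w j)

cliques-bounded : {k : ℕ} {a : Vec Bool k → ℕ} (C : PatternColouring k a) (b : Vec Bool k) (S : Subset (prodAll k a)) →
  IsClique (proj₁ (OrderMatching.matching (order C))) (partitePattern b) S → ∣ S ∣ ≤ a b
cliques-bounded {a = a} C b S clique =
  ≤-trans (injectiveOn⇒∣p∣≤∣q∣ S full (colour C b) (λ _ → ∈⊤) distinct) (≤-reflexive (∣⊤∣≡n (a b)))
  where
  open OrderMatching (order C)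
  distinct : ∀ {x y} → x ∈ₛ S → y ∈ₛ S → colour C b x ≡ colour C b y → x ≡ y
  distinct {x} {y} x∈ y∈ same with x ≟F y
  ... | yes x≡y = x≡y
  ... | no  x≢y with clique x y x∈ y∈ x≢y
  ...   | inj₁ xy = ⊥-elim (proper C b (word≡pattern⇒precedes x≢y xy) same)
  ...   | inj₂ yx = ⊥-elim (proper C b (word≡pattern⇒precedes (λ y≡x → x≢y (sym y≡x)) yx) (sym same))

corollary1p5 : (r : ℕ) → 2 ≤ r →
  (a : Vec Bool (r ∸ 1) → ℕ) → ((b : Vec Bool (r ∸ 1)) → 1 ≤ a b) →
  ((n : ℕ) → suc (prodAll (r ∸ 1) a) ≤ n → (M : PartiteMatching r n) →
     Σ (Vec Bool (r ∸ 1)) λ b → Σ (Subset n) λ S →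
       IsClique (proj₁ M) (partitePattern b) S × suc (a b) ≤ ∣ S ∣)
  ×
  Σ (PartiteMatching r (prodAll (r ∸ 1) a)) λ M →
    (b : Vec Bool (r ∸ 1)) (S : Subset (prodAll (r ∸ 1) a)) →
      IsClique (proj₁ M) (partitePattern b) S → ∣ S ∣ ≢ suc (a b)
corollary1p5 (suc (suc k)) (s≤s (s≤s z≤n)) a a≥1 =
  largeClique (suc k) a a≥1 ,
  (OrderMatching.matching (order C) ,
   λ b S clique size → <-irrefl refl (subst (_≤ a b) size (cliques-bounded C b S clique)))
  where
  C : PatternColouring (suc k) a
  C = patternColouring (suc k) a
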